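{- Let $m\geq 3$ be an odd integer and let $c$ be an integer with $\gcd(c,m)=1$. Then for every residue $r\in\{0,1,\dots,m-1\}$ there is an integer $n_r\geq 0$ such that $2^{n_r}+cn_r\equiv r\pmod m$. Equivalently, the sequence $\{2^n+cn\bmod m\}_{n\geq 0}$ visits all $m$ residue classes modulo $m$. -}

-- Strong induction on m. For m > 1 the powers of a are periodic modulo m with a period
-- 0 < t < m: none of a⁰, …, aᵐ⁻¹ is 0 modulo m, so two of them share a residue. Put
-- g = gcd t m < m and take, by induction, i with aⁱ + c i ≡ r (mod g). Along n = i + t k the
-- power aⁿ stays ≡ aⁱ (mod m) while c n moves by c t k; as c is a unit modulo m and t
-- generates the multiples of g modulo m, some k makes up the error aⁱ + c i − r ∈ g ℤ.

module Submission where

open import Data.Nat using (ℕ; _≤_; _<_)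
open import Data.Integer using (ℤ; +_; _+_; _-_; _*_; _^_)
open import Data.Integer.Coprimality using (Coprime)
open import Data.Integer.Divisibility using (_∣_)
open import Data.Product using (∃)
open import Relation.Nullary using (¬_)

open import Data.Nat using (zero; suc; NonZero; _∸_; z<s; s<s; >-nonZero; ≢-nonZero)
import Data.Nat as ℕ
import Data.Nat.Properties as ℕ
import Data.Nat.Divisibility as ℕ
import Data.Nat.Coprimality as ℕ
open import Data.Nat.Divisibility using (∣1⇒≡1; ∣⇒≤)
open import Data.Nat.Coprimality using (coprime-Bézout)
open import Data.Nat.GCD using (gcd; gcd-GCD; gcd[m,n]∣m; gcd[m,n]∣n; gcd[m,n]≢0; module Bézout)
open import Data.Nat.Primality using (Prime; prime[2]; prime⇒irreducible)
open import Data.Nat.Induction using (<-wellFounded)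
open import Induction.WellFounded using (Acc; acc)
open import Data.Integer using (-[1+_]; -_; 0ℤ; 1ℤ)
import Data.Integer.Properties as ℤ
import Data.Integer.Coprimality as Coprime
open import Data.Integer.Coprimality using (coprime-divisor)
open import Data.Integer.Divisibility.Signed
  using (divides; ∣m∣n⇒∣m+n; ∣m⇒∣-m; ∣n⇒∣m*n; ∣m⇒∣m*n; ∣ᵤ⇒∣; ∣⇒∣ᵤ) renaming (_∣_ to _∣ₛ_)
open import Data.Integer.DivMod using (_%ℕ_; _/ℕ_; a≡a%ℕn+[a/ℕn]*n; n%ℕd<d)
open import Data.Integer.Tactic.RingSolver using (solve-∀)
open import Data.Fin as Fin using (Fin; toℕ; fromℕ<; punchOut)
open import Data.Fin.Properties using (pigeonhole; toℕ<n; fromℕ<-injective; punchOut-injective)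
open import Data.Product using (_×_; _,_)
open import Data.Sum using (inj₁; inj₂)
open import Relation.Nullary using (contradiction)
open import Relation.Binary.Bundles using (Setoid)
import Relation.Binary.Reasoning.Setoid as SetoidReasoning
open import Relation.Binary.PropositionalEquality
  using (_≡_; _≢_; refl; sym; trans; cong; cong₂; subst; subst₂; module ≡-Reasoning)

infix 4 _≡_mod_

-- A record rather than a synonym for + m ∣ x - y, so that x and y can be inferred.
record _≡_mod_ (x y : ℤ) (m : ℕ) : Set where
  constructor congruent
  field divides-difference : + m ∣ₛ x - y

module _ {m : ℕ} where

  ≡-mod-refl : ∀ {x} → x ≡ x mod m
  ≡-mod-refl {x} = congruent (divides 0ℤ (ℤ.+-inverseʳ x))

  ≡-mod-sym : ∀ {x y} → x ≡ y mod m → y ≡ x mod m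
  ≡-mod-sym {x} {y} (congruent m∣x-y) = congruent (subst (+ m ∣ₛ_) (negate x y) (∣m⇒∣-m m∣x-y))
    where
    negate : ∀ x y → - (x - y) ≡ y - x
    negate = solve-∀

  ≡-mod-trans : ∀ {x y z} → x ≡ y mod m → y ≡ z mod m → x ≡ z mod m
  ≡-mod-trans {x} {y} {z} (congruent m∣x-y) (congruent m∣y-z) =
    congruent (subst (+ m ∣ₛ_) (telescope x y z) (∣m∣n⇒∣m+n m∣x-y m∣y-z))
    where
    telescope : ∀ x y z → (x - y) + (y - z) ≡ x - z
    telescope = solve-∀

  +-cong-mod : ∀ {x y u v} → x ≡ y mod m → u ≡ v mod m → x + u ≡ y + v mod m
  +-cong-mod {x} {y} {u} {v} (congruent m∣x-y) (congruent m∣u-v) =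
    congruent (subst (+ m ∣ₛ_) (regroup x y u v) (∣m∣n⇒∣m+n m∣x-y m∣u-v))
    where
    regroup : ∀ x y u v → (x - y) + (u - v) ≡ (x + u) - (y + v)
    regroup = solve-∀

  *-cong-mod : ∀ {x y u v} → x ≡ y mod m → u ≡ v mod m → x * u ≡ y * v mod m
  *-cong-mod {x} {y} {u} {v} (congruent m∣x-y) (congruent m∣u-v) =
    congruent (subst (+ m ∣ₛ_) (regroup x y u v) (∣m∣n⇒∣m+n (∣m⇒∣m*n u m∣x-y) (∣n⇒∣m*n y m∣u-v)))
    where
    regroup : ∀ x y u v → (x - y) * u + y * (u - v) ≡ x * u - y * v
    regroup = solve-∀

  +-congˡ-mod : ∀ x {u v} → u ≡ v mod m → x + u ≡ x + v mod m
  +-congˡ-mod x = +-cong-mod (≡-mod-refl {x})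

  *-congˡ-mod : ∀ x {u v} → u ≡ v mod m → x * u ≡ x * v mod m
  *-congˡ-mod x = *-cong-mod (≡-mod-refl {x})

  *-congʳ-mod : ∀ x {u v} → u ≡ v mod m → u * x ≡ v * x mod m
  *-congʳ-mod x u≡v = *-cong-mod u≡v (≡-mod-refl {x})

  ^-cong-mod : ∀ {x y} n → x ≡ y mod m → x ^ n ≡ y ^ n mod m
  ^-cong-mod zero    x≡y = ≡-mod-refl
  ^-cong-mod (suc n) x≡y = *-cong-mod x≡y (^-cong-mod n x≡y)

  +-multiple≡-mod : ∀ x q → x + q * + m ≡ x mod m
  +-multiple≡-mod x q = congruent (divides q (cancel x (q * + m)))
    where
    cancel : ∀ x y → x + y - x ≡ y
    cancel = solve-∀

≡-mod-setoid : ℕ → Setoid _ _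
≡-mod-setoid m = record
  { _≈_ = λ x y → x ≡ y mod m
  ; isEquivalence = record { refl = ≡-mod-refl ; sym = ≡-mod-sym ; trans = ≡-mod-trans }
  }

≡-mod-1 : ∀ {x y} → x ≡ y mod 1
≡-mod-1 {x} {y} = congruent (divides (x - y) (sym (ℤ.*-identityʳ (x - y))))

≡-mod-%ℕ : ∀ x m .{{_ : NonZero m}} → x ≡ + (x %ℕ m) mod m
≡-mod-%ℕ x m =
  subst (_≡ + (x %ℕ m) mod m) (sym (a≡a%ℕn+[a/ℕn]*n x m)) (+-multiple≡-mod (+ (x %ℕ m)) (x /ℕ m))

%ℕ-≡⇒≡-mod : ∀ {x y} m .{{_ : NonZero m}} → x %ℕ m ≡ y %ℕ m → x ≡ y mod m
%ℕ-≡⇒≡-mod {x} {y} m x%m≡y%m = ≡-mod-trans (≡-mod-%ℕ x m)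
  (subst (_≡ y mod m) (cong +_ (sym x%m≡y%m)) (≡-mod-sym (≡-mod-%ℕ y m)))

*-cancelˡ-mod : ∀ {m} a {x y} → Coprime a (+ m) → a * x ≡ a * y mod m → x ≡ y mod m
*-cancelˡ-mod {m} a {x} {y} a⊥m (congruent m∣ax-ay) =
  congruent (∣ᵤ⇒∣ (coprime-divisor (+ m) a (x - y) (Coprime.sym {a} {+ m} a⊥m)
    (∣⇒∣ᵤ (subst (+ m ∣ₛ_) (factor a x y) m∣ax-ay))))
  where
  factor : ∀ a x y → a * x - a * y ≡ a * (x - y)
  factor = solve-∀

^-cancelˡ-mod : ∀ {m} a {x y} → Coprime a (+ m) → ∀ i → a ^ i * x ≡ a ^ i * y mod m → x ≡ y mod m
^-cancelˡ-mod a {x} {y} a⊥m zero    aⁱx≡aⁱy =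
  subst₂ (_≡_mod _) (ℤ.*-identityˡ x) (ℤ.*-identityˡ y) aⁱx≡aⁱy
^-cancelˡ-mod a {x} {y} a⊥m (suc i) aⁱx≡aⁱy =
  ^-cancelˡ-mod a a⊥m i (*-cancelˡ-mod a a⊥m
    (subst₂ (_≡_mod _) (ℤ.*-assoc a (a ^ i) x) (ℤ.*-assoc a (a ^ i) y) aⁱx≡aⁱy))

1≢0-mod : ∀ {m} → 1 < m → ¬ (1ℤ ≡ 0ℤ mod m)
1≢0-mod 1<m (congruent m∣1) = ℕ.<⇒≢ 1<m (sym (∣1⇒≡1 (∣⇒∣ᵤ m∣1)))

^≢0-mod : ∀ {m} a → 1 < m → Coprime a (+ m) → ∀ e → ¬ (a ^ e ≡ 0ℤ mod m)
^≢0-mod a 1<m a⊥m e aᵉ≡0 = 1≢0-mod 1<m (^-cancelˡ-mod a a⊥m e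
  (subst₂ (_≡_mod _) (sym (ℤ.*-identityʳ (a ^ e))) (sym (ℤ.*-zeroʳ (a ^ e))) aᵉ≡0))

^≡^⇒^[j∸i]≡1 : ∀ {m} a → Coprime a (+ m) → ∀ {i j} → i ≤ j →
               a ^ i ≡ a ^ j mod m → a ^ (j ∸ i) ≡ 1ℤ mod m
^≡^⇒^[j∸i]≡1 {m} a a⊥m {i} {j} i≤j aⁱ≡aʲ = ≡-mod-sym (^-cancelˡ-mod a a⊥m i
  (subst₂ (_≡_mod m) (sym (ℤ.*-identityʳ (a ^ i))) aʲ≡aⁱ*aʲ⁻ⁱ aⁱ≡aʲ))
  where
  aʲ≡aⁱ*aʲ⁻ⁱ : a ^ j ≡ a ^ i * a ^ (j ∸ i)
  aʲ≡aⁱ*aʲ⁻ⁱ = trans (cong (a ^_) (sym (ℕ.m+[n∸m]≡n i≤j))) (ℤ.^-distribˡ-+-* a i (j ∸ i))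

∃-period : ∀ {m} a → 1 < m → Coprime a (+ m) → ∃ λ t → 0 < t × t < m × a ^ t ≡ 1ℤ mod m
∃-period {suc m} a 1<m a⊥m =
  let i , j , i<j , same = pigeonhole (ℕ.n<1+n m) nonzeroResidue in
  toℕ j ∸ toℕ i , ℕ.m<n⇒0<n∸m i<j , ℕ.≤-<-trans (ℕ.m∸n≤m (toℕ j) (toℕ i)) (toℕ<n j)
  , ^≡^⇒^[j∸i]≡1 a a⊥m (ℕ.<⇒≤ i<j) (%ℕ-≡⇒≡-mod (suc m)
      (fromℕ<-injective _ _ _ _ (punchOut-injective (0≢residue (toℕ i)) (0≢residue (toℕ j)) same)))
  where
  residue : ℕ → Fin (suc m)
  residue e = fromℕ< (n%ℕd<d (a ^ e) (suc m))

  0≢residue : ∀ e → Fin.zero ≢ residue e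
  0≢residue e 0≡r = ^≢0-mod a 1<m a⊥m e (subst (a ^ e ≡_mod suc m)
    (cong +_ (sym (fromℕ<-injective 0 _ z<s _ 0≡r))) (≡-mod-%ℕ (a ^ e) (suc m)))

  nonzeroResidue : Fin (suc m) → Fin m
  nonzeroResidue e = punchOut (0≢residue (toℕ e))

pos-cong-+-* : ∀ d x m y t → d ℕ.+ x ℕ.* m ≡ y ℕ.* t → + d + + x * + m ≡ + y * + t
pos-cong-+-* d x m y t eq = begin
  + d + + x * + m    ≡⟨ cong (_+_ (+ d)) (ℤ.pos-* x m) ⟨
  + d + + (x ℕ.* m)  ≡⟨ ℤ.pos-+ d (x ℕ.* m) ⟨
  + (d ℕ.+ x ℕ.* m)  ≡⟨ cong +_ eq ⟩
  + (y ℕ.* t)        ≡⟨ ℤ.pos-* y t ⟩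
  + y * + t          ∎
  where open ≡-Reasoning

Bézout⇒≡-mod : ∀ {d t m} → Bézout.Identity d t m → ∃ λ α → α * + t ≡ + d mod m
Bézout⇒≡-mod {d} {t} {m} (Bézout.+- x y eq) =
  + x , congruent (divides (+ y)
    (trans (cong (_- + d) (sym (pos-cong-+-* d y m x t eq))) (cancel (+ d) (+ y * + m))))
  where
  cancel : ∀ d e → d + e - d ≡ e
  cancel = solve-∀
Bézout⇒≡-mod {d} {t} {m} (Bézout.-+ x y eq) =
  - + x , congruent (divides (- + y) (trans (negate (+ d) (+ x) (+ t))
    (trans (cong -_ (pos-cong-+-* d x t y m eq)) (ℤ.neg-distribˡ-* (+ y) (+ m)))))
  where
  negate : ∀ d x t → (- x) * t - d ≡ - (d + x * t)
  negate = solve-∀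

∃-inverse-mod : ∀ {m} c → Coprime c (+ m) → ∃ λ u → u * c ≡ 1ℤ mod m
∃-inverse-mod (+ n)    c⊥m = Bézout⇒≡-mod (coprime-Bézout c⊥m)
∃-inverse-mod -[1+ n ] c⊥m =
  let α , α∣c∣≡1 = Bézout⇒≡-mod (coprime-Bézout c⊥m)
  in - α , subst (_≡ 1ℤ mod _) (negate α (+ suc n)) α∣c∣≡1
  where
  negate : ∀ α c → α * c ≡ (- α) * (- c)
  negate = solve-∀

gcd-Bézout-mod : ∀ t m → ∃ λ α → α * + t ≡ + gcd t m mod m
gcd-Bézout-mod t m = Bézout⇒≡-mod (Bézout.identity (gcd-GCD t m))

lift-solution : ∀ {m t g} .{{_ : NonZero m}} {a c r} →
                a ^ t ≡ 1ℤ mod m → (∃ λ u → u * c ≡ 1ℤ mod m) → (∃ λ α → α * + t ≡ + g mod m) →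
                ∀ {i} → a ^ i + c * + i ≡ r mod g → ∃ λ n → a ^ n + c * + n ≡ r mod m
lift-solution {m} {t} {g} {a} {c} {r} aᵗ≡1 (u , uc≡1) (α , αt≡g) {i}
              (congruent (divides s aⁱ+ci-r≡sg)) =
  n , (begin
  a ^ n + c * + n                              ≡⟨ cong₂ _+_ aⁿ≡aⁱ*[aᵗ]ᵏ (cong (c *_) n≡i+tk) ⟩
  a ^ i * (a ^ t) ^ k + c * (+ i + + t * + k)  ≈⟨ +-cong-mod (*-congˡ-mod (a ^ i) (^-cong-mod k aᵗ≡1))
                                                    (*-congˡ-mod c (+-congˡ-mod (+ i) (*-congˡ-mod (+ t) k≡k′))) ⟩
  a ^ i * 1ℤ ^ k + c * (+ i + + t * k′)       ≡⟨ cong (λ z → a ^ i * z + c * (+ i + + t * k′)) (ℤ.^-zeroˡ k) ⟩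
  a ^ i * 1ℤ + c * (+ i + + t * k′)           ≡⟨ regroup (a ^ i) c (+ i) (+ t) s α u ⟩
  a ^ i + c * + i + (u * c) * (α * + t) * - s ≈⟨ +-congˡ-mod (a ^ i + c * + i) (*-congʳ-mod (- s) (*-cong-mod uc≡1 αt≡g)) ⟩
  a ^ i + c * + i + 1ℤ * + g * - s            ≡⟨ subtract (a ^ i + c * + i) (+ g) s ⟩
  a ^ i + c * + i - s * + g                   ≡⟨ cong (_-_ (a ^ i + c * + i)) aⁱ+ci-r≡sg ⟨
  a ^ i + c * + i - (a ^ i + c * + i - r)     ≡⟨ x-[x-y]≡y (a ^ i + c * + i) r ⟩
  r                                            ∎)
  where
  open SetoidReasoning (≡-mod-setoid m)
  -- c t k′ ≡ − s g (mod m), which cancels aⁱ + c i − r = s g.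
  k′ = - (s * α * u)
  k = k′ %ℕ m
  n = i ℕ.+ t ℕ.* k
  aⁿ≡aⁱ*[aᵗ]ᵏ : a ^ n ≡ a ^ i * (a ^ t) ^ k
  aⁿ≡aⁱ*[aᵗ]ᵏ = trans (ℤ.^-distribˡ-+-* a i (t ℕ.* k)) (cong (a ^ i *_) (sym (ℤ.^-*-assoc a t k)))
  n≡i+tk : + n ≡ + i + + t * + k
  n≡i+tk = trans (ℤ.pos-+ i (t ℕ.* k)) (cong (_+_ (+ i)) (ℤ.pos-* t k))
  k≡k′ : + k ≡ k′ mod m
  k≡k′ = ≡-mod-sym (≡-mod-%ℕ k′ m)
  regroup : ∀ A c i t s α u → A * 1ℤ + c * (i + t * - (s * α * u)) ≡ A + c * i + u * c * (α * t) * - s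
  regroup = solve-∀
  subtract : ∀ x g s → x + 1ℤ * g * - s ≡ x - s * g
  subtract = solve-∀
  x-[x-y]≡y : ∀ x y → x - (x - y) ≡ y
  x-[x-y]≡y = solve-∀

prime∧∤⇒coprime : ∀ {p n} → Prime p → ¬ p ℕ.∣ n → ℕ.Coprime p n
prime∧∤⇒coprime p-prime p∤n (d∣p , d∣n) with prime⇒irreducible p-prime d∣p
... | inj₁ d≡1  = d≡1
... | inj₂ refl = contradiction d∣n p∤n

coprime-∣ʳ : ∀ {a m g} → Coprime a (+ m) → g ℕ.∣ m → Coprime a (+ g)
coprime-∣ʳ a⊥m g∣m (d∣a , d∣g) = a⊥m (d∣a , ℕ.∣-trans d∣g g∣m)

gcd[m,n]<n : ∀ {t m} → 0 < t → t < m → gcd t m < m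
gcd[m,n]<n {t} {m} 0<t t<m = ℕ.≤-<-trans (∣⇒≤ {{>-nonZero 0<t}} (gcd[m,n]∣m t m)) t<m

a^n+cn-surjective-acc : ∀ {m} → Acc _<_ m → .{{_ : NonZero m}} → ∀ a c →
                        Coprime a (+ m) → Coprime c (+ m) → ∀ r → ∃ λ n → a ^ n + c * + n ≡ r mod m
a^n+cn-surjective-acc {1} _ a c _ _ r = 0 , ≡-mod-1
a^n+cn-surjective-acc {m@(suc (suc _))} (acc smaller) a c a⊥m c⊥m r =
  let t , 0<t , t<m , aᵗ≡1 = ∃-period a (s<s z<s) a⊥m
      g∣m = gcd[m,n]∣n t m
      instance
        g≢0 : NonZero (gcd t m)
        g≢0 = ≢-nonZero (gcd[m,n]≢0 t m (inj₂ λ ()))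
      i , solution-mod-g = a^n+cn-surjective-acc (smaller (gcd[m,n]<n 0<t t<m)) a c
                             (coprime-∣ʳ {a} a⊥m g∣m) (coprime-∣ʳ {c} c⊥m g∣m) r
  in lift-solution aᵗ≡1 (∃-inverse-mod c c⊥m) (gcd-Bézout-mod t m) {i} solution-mod-g

a^n+cn-surjective : ∀ m .{{_ : NonZero m}} a c → Coprime a (+ m) → Coprime c (+ m) →
                    ∀ r → ∃ λ n → a ^ n + c * + n ≡ r mod m
a^n+cn-surjective m = a^n+cn-surjective-acc (<-wellFounded m)

mainTheorem3 : (m : ℕ) → 3 ≤ m → ¬ ((+ 2) ∣ (+ m)) → (c : ℤ) → Coprime c (+ m) →
    (r : ℕ) → r < m → ∃ λ (n : ℕ) → (+ m) ∣ (((+ 2) ^ n + c * (+ n)) - (+ r))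
mainTheorem3 m 3≤m 2∤m c c⊥m r _ =
  let instance
        m≢0 : NonZero m
        m≢0 = >-nonZero (ℕ.<-≤-trans z<s 3≤m)
      n , 2ⁿ+cn≡r = a^n+cn-surjective m (+ 2) c (prime∧∤⇒coprime prime[2] 2∤m) c⊥m (+ r)
  in n , ∣⇒∣ᵤ (_≡_mod_.divides-difference 2ⁿ+cn≡r)
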